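{- Let $G$ be a connected $(P_5, K_1+(K_1\cup K_3))$-free graph with no clique cutset, let $C=v_1v_2v_3v_4v_5v_1$ be a $5$-hole of $G$, let $T$ be a component of $G[N^2(C)]$, and suppose $\mathcal{N}^{(3,2)}(C)\cup\mathcal{N}^{(4)}(C)\neq\emptyset$. Then (a) if $N(V(T))\cap(\mathcal{N}^{(3,2)}(C)\cup\mathcal{N}^{(4)}(C))\neq\emptyset$ and $\omega(G[N_{\{1,2,3,4,5\}}(C)])\ge 2$, then $T$ consists of a single vertex, which has a neighbor in $N_{\{1,2,3,4,5\}}(C)$; (b) if $N(V(T))\cap(\mathcal{N}^{(3,2)}(C)\cup\mathcal{N}^{(4)}(C))=\emptyset$, then $T$ is $K_3$-free.
   Context: All graphs are finite and simple. $K_1+(K_1\cup K_3)$ is $K_4$ plus a new vertex adjacent to exactly one vertex of the $K_4$; $(P_5,K_1+(K_1\cup K_3))$-free means no induced subgraph isomorphic to the five-vertex path or to this graph. A clique cutset is a clique whose removal disconnects the graph. A $5$-hole is an induced $5$-cycle; indices mod $5$. $N(X)$ is the set of vertices outside $X$ with a neighbor in $X$; $N(C)=N(V(C))$; $N^2(C)$ is the set of vertices at distance exactly $2$ from $V(C)$. For $T'\subseteq\{1,\dots,5\}$, $N_{T'}(C)=\{x\in N(C): xv_j\in E(G)\text{ iff } j\in T'\}$. $\mathcal{N}^{(3,2)}(C)=\bigcup_{i=1}^5 N_{\{i,i+1,i+3\}}(C)$ and $\mathcal{N}^{(4)}(C)=\bigcup_{i=1}^5 N_{\{i,i+1,i+2,i+3\}}(C)$.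 $\omega$ is clique number. -}

module Defs where

open import Data.Nat using (ℕ)
open import Data.Fin using (Fin; zero; suc)
open import Data.Product using (Σ; ∃; ∃-syntax; _×_; _,_)
open import Data.Sum using (_⊎_)
open import Data.Unit using (⊤)
open import Data.Empty using (⊥)
open import Relation.Nullary using (¬_; Dec)
open import Relation.Binary.PropositionalEquality using (_≡_; _≢_)

_⟺_ : Set → Set → Set
A ⟺ B = (A → B) × (B → A)

record Graph : Set₁ where
  field
    n     : ℕ
    Adj   : Fin n → Fin n → Set
    adj?  : ∀ u v → Dec (Adj u v)
    sym   : ∀ {u v} → Adj u v → Adj v u
    irr   : ∀ {u} → ¬ Adj u u

open Graph public

V : Graph → Set
V G = Fin (n G)

VSet : Graph → Set₁
VSet G = V G → Set

-- G contains an induced copy of the pattern graph on Fin k with adjacency h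
-- (h is only consulted on distinct pairs).
InducedCopy : (k : ℕ) → (Fin k → Fin k → Set) → Graph → Set
InducedCopy k h G =
  Σ (Fin k → V G) λ f →
    (∀ i j → f i ≡ f j → i ≡ j) ×
    (∀ i j → i ≢ j → (h i j ⟺ Adj G (f i) (f j)))

P5adj : Fin 5 → Fin 5 → Set
P5adj zero (suc zero) = ⊤
P5adj (suc zero) zero = ⊤
P5adj (suc zero) (suc (suc zero)) = ⊤
P5adj (suc (suc zero)) (suc zero) = ⊤
P5adj (suc (suc zero)) (suc (suc (suc zero))) = ⊤
P5adj (suc (suc (suc zero))) (suc (suc zero)) = ⊤
P5adj (suc (suc (suc zero))) (suc (suc (suc (suc zero)))) = ⊤
P5adj (suc (suc (suc (suc zero)))) (suc (suc (suc zero))) = ⊤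
P5adj _ _ = ⊥

-- K1+(K1 ∪ K3): K4 on {0,1,2,3} plus vertex 4 adjacent exactly to 0
isK4 : Fin 5 → Set
isK4 (suc (suc (suc (suc zero)))) = ⊥
isK4 _ = ⊤

KPadj : Fin 5 → Fin 5 → Set
KPadj zero (suc (suc (suc (suc zero)))) = ⊤
KPadj (suc (suc (suc (suc zero)))) zero = ⊤
KPadj i j = isK4 i × isK4 j

P5Free : Graph → Set
P5Free G = ¬ InducedCopy 5 P5adj G

KPFree : Graph → Set
KPFree G = ¬ InducedCopy 5 KPadj G

data Reach (G : Graph) (S : VSet G) : V G → V G → Set where
  here : ∀ {u} → S u → Reach G S u u
  step : ∀ {u w v} → S u → Adj G u w → Reach G S w v → Reach G S u v

Connected : Graph → Set
Connected G = ∀ u v → Reach G (λ _ → ⊤) u v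

IsClique : (G : Graph) → VSet G → Set
IsClique G K = ∀ x y → K x → K y → x ≢ y → Adj G x y

IsCliqueCutset : (G : Graph) → VSet G → Set
IsCliqueCutset G K =
  IsClique G K ×
  ∃[ u ] ∃[ v ] (¬ K u × ¬ K v × ¬ Reach G (λ x → ¬ K x) u v)

NoCliqueCutset : Graph → Set₁
NoCliqueCutset G = ∀ (K : VSet G) → ¬ IsCliqueCutset G K

-- indices of the hole: Fin 5, with v_1..v_5 ↦ 0..4; successor mod 5
s5 : Fin 5 → Fin 5
s5 zero = suc zero
s5 (suc zero) = suc (suc zero)
s5 (suc (suc zero)) = suc (suc (suc zero))
s5 (suc (suc (suc zero))) = suc (suc (suc (suc zero)))
s5 (suc (suc (suc (suc zero)))) = zero

IsHole5 : (G : Graph) → (Fin 5 → V G) → Set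
IsHole5 G c =
  (∀ i j → c i ≡ c j → i ≡ j) ×
  (∀ i j → (Adj G (c i) (c j) ⟺ (j ≡ s5 i ⊎ i ≡ s5 j)))

module _ (G : Graph) (c : Fin 5 → V G) where

  InC : VSet G
  InC x = ∃[ i ] x ≡ c i

  NC : VSet G
  NC x = ¬ InC x × ∃[ j ] Adj G x (c j)

  N2 : VSet G
  N2 x = ¬ InC x × ¬ NC x × ∃[ y ] (NC y × Adj G x y)

  NT : (Fin 5 → Set) → VSet G
  NT T' x = NC x × (∀ j → (Adj G x (c j) ⟺ T' j))

  N32 : VSet G
  N32 x = ∃[ i ] NT (λ j → j ≡ i ⊎ j ≡ s5 i ⊎ j ≡ s5 (s5 (s5 i))) x

  N4 : VSet G
  N4 x = ∃[ i ] NT (λ j → j ≡ i ⊎ j ≡ s5 i ⊎ j ≡ s5 (s5 i) ⊎ j ≡ s5 (s5 (s5 i))) x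

  N12345 : VSet G
  N12345 = NT (λ _ → ⊤)

IsComponent : (G : Graph) → VSet G → VSet G → Set
IsComponent G S T =
  (∀ x → T x → S x) ×
  (∃[ t ] T t) ×
  (∀ x y → T x → T y → Reach G T x y) ×
  (∀ x y → T x → S y → Adj G x y → T y)

Nbd : (G : Graph) → VSet G → VSet G
Nbd G X x = ¬ X x × ∃[ y ] (X y × Adj G x y)

CliqueNumberGE2 : (G : Graph) → VSet G → Set
CliqueNumberGE2 G S = ∃[ x ] ∃[ y ] (S x × S y × Adj G x y)

K3Free : (G : Graph) → VSet G → Set
K3Free G T = ¬ (∃[ x ] ∃[ y ] ∃[ z ]
  (T x × T y × T z × Adj G x y × Adj G y z × Adj G x z))

-- Two forbidden configurations do all the work: an induced P5 and a K4 with a pendant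
-- vertex. A vertex y of N(C) with a neighbour a in N²(C) sees C in one of the patterns
-- {i,i+1,i+3}, {i,i+1,i+2,i+3} or {1,…,5}, because any other attachment set contains some
-- c_j followed or preceded by two unseen vertices, and a y c_j c_{j±1} c_{j±2} is a P5.
-- Every vertex w of N32 ∪ N4 sees c_i, c_{i+1}, c_{i+3} and misses c_{i+4}.
-- (a) w sees an end u of the edge inside N12345 (else K4 on c_{i+3}, c_{i+4} and that
-- edge, pendant w), u inherits w's neighbours in T (else K4 on w, u, c_i, c_{i+1}), and an
-- edge t t' of T, which w sees entirely by P5-freeness, gives a K4 on u, w, t, t'.
-- (b) Given a triangle a b d in T, a neighbour y of a in N(C) lies in N(T), hence sees all
-- of C; a vertex x of N32 ∪ N4 misses T, which forces y to miss x and then to see b and d,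
-- so c_1 is pendant to the K4 on y, a, b, d.

module Submission where

open import Defs
open import Data.Fin using (Fin; zero; suc)
open import Data.Fin.Properties using (all?; ¬∀⟶∃¬)
open import Data.Product using (∃; ∃-syntax; _×_; _,_; proj₁; proj₂)
open import Data.Sum using (_⊎_; inj₁; inj₂; [_,_]′)
open import Data.Empty using (⊥; ⊥-elim)
open import Data.Unit using (tt)
open import Function using (_∘_)
open import Relation.Nullary using (¬_; yes; no)
open import Relation.Unary using (Decidable)
open import Relation.Binary.PropositionalEquality
  using (_≡_; _≢_; refl; trans; cong; subst) renaming (sym to ≡-sym)

∀-Fin5 : {Q : Fin 5 → Set} →
  Q zero → Q (suc zero) → Q (suc (suc zero)) → Q (suc (suc (suc zero))) →
  Q (suc (suc (suc (suc zero)))) → ∀ j → Q j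
∀-Fin5 q₀ q₁ q₂ q₃ q₄ zero = q₀
∀-Fin5 q₀ q₁ q₂ q₃ q₄ (suc zero) = q₁
∀-Fin5 q₀ q₁ q₂ q₃ q₄ (suc (suc zero)) = q₂
∀-Fin5 q₀ q₁ q₂ q₃ q₄ (suc (suc (suc zero))) = q₃
∀-Fin5 q₀ q₁ q₂ q₃ q₄ (suc (suc (suc (suc zero)))) = q₄

∀-orbit : ∀ k {Q : Fin 5 → Set} →
  Q k → Q (s5 k) → Q (s5 (s5 k)) → Q (s5 (s5 (s5 k))) → Q (s5 (s5 (s5 (s5 k)))) →
  ∀ j → Q j
∀-orbit zero q₀ q₁ q₂ q₃ q₄ = ∀-Fin5 q₀ q₁ q₂ q₃ q₄
∀-orbit (suc zero) q₀ q₁ q₂ q₃ q₄ = ∀-Fin5 q₄ q₀ q₁ q₂ q₃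
∀-orbit (suc (suc zero)) q₀ q₁ q₂ q₃ q₄ = ∀-Fin5 q₃ q₄ q₀ q₁ q₂
∀-orbit (suc (suc (suc zero))) q₀ q₁ q₂ q₃ q₄ = ∀-Fin5 q₂ q₃ q₄ q₀ q₁
∀-orbit (suc (suc (suc (suc zero)))) q₀ q₁ q₂ q₃ q₄ = ∀-Fin5 q₁ q₂ q₃ q₄ q₀

s5-period : ∀ k → s5 (s5 (s5 (s5 (s5 k)))) ≡ k
s5-period zero = refl
s5-period (suc zero) = refl
s5-period (suc (suc zero)) = refl
s5-period (suc (suc (suc zero))) = refl
s5-period (suc (suc (suc (suc zero)))) = refl

≢s5 : ∀ k → k ≢ s5 k
≢s5 zero ()
≢s5 (suc zero) ()
≢s5 (suc (suc zero)) ()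
≢s5 (suc (suc (suc zero))) ()
≢s5 (suc (suc (suc (suc zero)))) ()

≢s5² : ∀ k → k ≢ s5 (s5 k)
≢s5² zero ()
≢s5² (suc zero) ()
≢s5² (suc (suc zero)) ()
≢s5² (suc (suc (suc zero))) ()
≢s5² (suc (suc (suc (suc zero)))) ()

≢s5³ : ∀ k → k ≢ s5 (s5 (s5 k))
≢s5³ zero ()
≢s5³ (suc zero) ()
≢s5³ (suc (suc zero)) ()
≢s5³ (suc (suc (suc zero))) ()
≢s5³ (suc (suc (suc (suc zero)))) ()

≢s5⁴ : ∀ k → k ≢ s5 (s5 (s5 (s5 k)))
≢s5⁴ zero ()
≢s5⁴ (suc zero) ()
≢s5⁴ (suc (suc zero)) ()
≢s5⁴ (suc (suc (suc zero))) ()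
≢s5⁴ (suc (suc (suc (suc zero)))) ()

Pattern32 Pattern4 : Fin 5 → Fin 5 → Set
Pattern32 i j = j ≡ i ⊎ j ≡ s5 i ⊎ j ≡ s5 (s5 (s5 i))
Pattern4 i j = j ≡ i ⊎ j ≡ s5 i ⊎ j ≡ s5 (s5 i) ⊎ j ≡ s5 (s5 (s5 i))

s5⁴∉Pattern32 : ∀ i → ¬ Pattern32 i (s5 (s5 (s5 (s5 i))))
s5⁴∉Pattern32 i =
  [ ≢s5⁴ i ∘ ≡-sym , [ ≢s5³ (s5 i) ∘ ≡-sym , ≢s5 (s5 (s5 (s5 i))) ∘ ≡-sym ]′ ]′

s5⁴∉Pattern4 : ∀ i → ¬ Pattern4 i (s5 (s5 (s5 (s5 i))))
s5⁴∉Pattern4 i =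
  [ ≢s5⁴ i ∘ ≡-sym , [ ≢s5³ (s5 i) ∘ ≡-sym
  , [ ≢s5² (s5 (s5 i)) ∘ ≡-sym , ≢s5 (s5 (s5 (s5 i))) ∘ ≡-sym ]′ ]′ ]′

present : {P Q : Set} → P → Q → P ⟺ Q
present p q = (λ _ → q) , (λ _ → p)

absent : {P Q : Set} → ¬ P → ¬ Q → P ⟺ Q
absent ¬p ¬q = ⊥-elim ∘ ¬p , ⊥-elim ∘ ¬q

Pattern32⊎4⊎Full : (Fin 5 → Set) → Set
Pattern32⊎4⊎Full P =
  (∃[ i ] ∀ j → P j ⟺ Pattern32 i j) ⊎ (∃[ i ] ∀ j → P j ⟺ Pattern4 i j) ⊎ (∀ j → P j)

module _ {P : Fin 5 → Set} (P? : Decidable P)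
         (no-gap-after : ∀ j → P j → ¬ P (s5 j) → ¬ P (s5 (s5 j)) → ⊥)
         (no-gap-before : ∀ j → P (s5 (s5 j)) → ¬ P (s5 j) → ¬ P j → ⊥) where

  module _ (k : Fin 5) (¬p₀ : ¬ P k) where
    private
      k₁ k₂ k₃ k₄ : Fin 5
      k₁ = s5 k
      k₂ = s5 k₁
      k₃ = s5 k₂
      k₄ = s5 k₃
      wrap : ∀ {x} → x ≡ s5 (s5 k₄) → x ≡ k₁
      wrap e = trans e (cong s5 (s5-period k))
      ¬p₅ : ¬ P (s5 k₄)
      ¬p₅ = ¬p₀ ∘ subst P (s5-period k)

    classify-from-missing : ∃ P → Pattern32⊎4⊎Full P
    classify-from-missing (j , pj) with P? k₁ | P? k₂ | P? k₃ | P? k₄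
    ... | yes p₁ | yes p₂ | yes p₃ | yes p₄ =
      inj₂ (inj₁ (k₁ , ∀-orbit k
        (absent ¬p₀ [ ≢s5 k , [ ≢s5² k , [ ≢s5³ k , ≢s5⁴ k ]′ ]′ ]′)
        (present p₁ (inj₁ refl)) (present p₂ (inj₂ (inj₁ refl)))
        (present p₃ (inj₂ (inj₂ (inj₁ refl)))) (present p₄ (inj₂ (inj₂ (inj₂ refl))))))
    ... | yes p₁ | yes p₂ | yes p₃ | no ¬p₄ = ⊥-elim (no-gap-after k₃ p₃ ¬p₄ ¬p₅)
    ... | yes p₁ | yes p₂ | no ¬p₃ | yes p₄ =
      inj₁ (k₁ , ∀-orbit k
        (absent ¬p₀ [ ≢s5 k , [ ≢s5² k , ≢s5⁴ k ]′ ]′)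
        (present p₁ (inj₁ refl)) (present p₂ (inj₂ (inj₁ refl)))
        (absent ¬p₃ [ ≢s5² k₁ ∘ ≡-sym , [ ≢s5 k₂ ∘ ≡-sym , ≢s5 k₃ ]′ ]′)
        (present p₄ (inj₂ (inj₂ refl))))
    ... | yes p₁ | yes p₂ | no ¬p₃ | no ¬p₄ = ⊥-elim (no-gap-after k₂ p₂ ¬p₃ ¬p₄)
    ... | yes p₁ | no ¬p₂ | yes p₃ | yes p₄ =
      inj₁ (k₃ , ∀-orbit k
        (absent ¬p₀ [ ≢s5³ k , [ ≢s5⁴ k , ≢s5 k ∘ wrap ]′ ]′)
        (present p₁ (inj₂ (inj₂ (≡-sym (cong s5 (s5-period k))))))
        (absent ¬p₂ [ ≢s5 k₂ , [ ≢s5² k₂ , ≢s5 k₁ ∘ ≡-sym ∘ wrap ]′ ]′)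
        (present p₃ (inj₁ refl)) (present p₄ (inj₂ (inj₁ refl))))
    ... | yes p₁ | no ¬p₂ | yes p₃ | no ¬p₄ = ⊥-elim (no-gap-after k₃ p₃ ¬p₄ ¬p₅)
    ... | yes p₁ | no ¬p₂ | no ¬p₃ | _ = ⊥-elim (no-gap-after k₁ p₁ ¬p₂ ¬p₃)
    ... | no ¬p₁ | yes p₂ | _ | _ = ⊥-elim (no-gap-before k p₂ ¬p₁ ¬p₀)
    ... | no ¬p₁ | no ¬p₂ | yes p₃ | _ = ⊥-elim (no-gap-before k₁ p₃ ¬p₂ ¬p₁)
    ... | no ¬p₁ | no ¬p₂ | no ¬p₃ | yes p₄ = ⊥-elim (no-gap-before k₂ p₄ ¬p₃ ¬p₂)
    ... | no ¬p₁ | no ¬p₂ | no ¬p₃ | no ¬p₄ = ⊥-elim (∀-orbit k {¬_ ∘ P} ¬p₀ ¬p₁ ¬p₂ ¬p₃ ¬p₄ j pj)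

  classify-gap-free : ∃ P → Pattern32⊎4⊎Full P
  classify-gap-free nonempty with all? P?
  ... | yes all = inj₂ (inj₂ all)
  ... | no ¬all = let k , ¬p₀ = ¬∀⟶∃¬ 5 P P? ¬all in classify-from-missing k ¬p₀ nonempty

module _ (G : Graph) where

  adj-≢ : ∀ {u v} → Adj G u v → u ≢ v
  adj-≢ e refl = irr G e

  separated-≢ : ∀ {w u v} → Adj G w u → ¬ Adj G w v → u ≢ v
  separated-≢ e ¬e refl = ¬e e

  ¬sym : ∀ {u v} → ¬ Adj G u v → ¬ Adj G v u
  ¬sym ¬e = ¬e ∘ sym G

  module InducedP5 {x₀ x₁ x₂ x₃ x₄ : V G}
    (e₀₁ : Adj G x₀ x₁) (e₁₂ : Adj G x₁ x₂) (e₂₃ : Adj G x₂ x₃) (e₃₄ : Adj G x₃ x₄)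
    (n₀₂ : ¬ Adj G x₀ x₂) (n₀₃ : ¬ Adj G x₀ x₃) (n₀₄ : ¬ Adj G x₀ x₄)
    (n₁₃ : ¬ Adj G x₁ x₃) (n₁₄ : ¬ Adj G x₁ x₄) (n₂₄ : ¬ Adj G x₂ x₄) where

    vertex : Fin 5 → V G
    vertex = ∀-Fin5 x₀ x₁ x₂ x₃ x₄

    injective : ∀ i j → vertex i ≡ vertex j → i ≡ j
    injective zero zero _ = refl
    injective zero (suc zero) e = ⊥-elim (adj-≢ e₀₁ e)
    injective zero (suc (suc zero)) e = ⊥-elim (separated-≢ (sym G e₂₃) (¬sym n₀₃) (≡-sym e))
    injective zero (suc (suc (suc zero))) e = ⊥-elim (separated-≢ (sym G e₀₁) n₁₃ e)
    injective zero (suc (suc (suc (suc zero)))) e = ⊥-elim (separated-≢ (sym G e₀₁) n₁₄ e)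
    injective (suc zero) zero e = ⊥-elim (adj-≢ (sym G e₀₁) e)
    injective (suc zero) (suc zero) _ = refl
    injective (suc zero) (suc (suc zero)) e = ⊥-elim (adj-≢ e₁₂ e)
    injective (suc zero) (suc (suc (suc zero))) e = ⊥-elim (separated-≢ e₀₁ n₀₃ e)
    injective (suc zero) (suc (suc (suc (suc zero)))) e = ⊥-elim (separated-≢ e₀₁ n₀₄ e)
    injective (suc (suc zero)) zero e = ⊥-elim (separated-≢ (sym G e₂₃) (¬sym n₀₃) e)
    injective (suc (suc zero)) (suc zero) e = ⊥-elim (adj-≢ (sym G e₁₂) e)
    injective (suc (suc zero)) (suc (suc zero)) _ = refl
    injective (suc (suc zero)) (suc (suc (suc zero))) e = ⊥-elim (adj-≢ e₂₃ e)
    injective (suc (suc zero)) (suc (suc (suc (suc zero)))) e = ⊥-elim (separated-≢ e₁₂ n₁₄ e)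
    injective (suc (suc (suc zero))) zero e = ⊥-elim (separated-≢ e₂₃ (¬sym n₀₂) e)
    injective (suc (suc (suc zero))) (suc zero) e = ⊥-elim (separated-≢ (sym G e₃₄) (¬sym n₁₄) e)
    injective (suc (suc (suc zero))) (suc (suc zero)) e = ⊥-elim (adj-≢ (sym G e₂₃) e)
    injective (suc (suc (suc zero))) (suc (suc (suc zero))) _ = refl
    injective (suc (suc (suc zero))) (suc (suc (suc (suc zero)))) e = ⊥-elim (adj-≢ e₃₄ e)
    injective (suc (suc (suc (suc zero)))) zero e = ⊥-elim (separated-≢ e₃₄ (¬sym n₀₃) e)
    injective (suc (suc (suc (suc zero)))) (suc zero) e = ⊥-elim (separated-≢ e₃₄ (¬sym n₁₃) e)
    injective (suc (suc (suc (suc zero)))) (suc (suc zero)) e = ⊥-elim (separated-≢ e₁₂ n₁₄ (≡-sym e))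
    injective (suc (suc (suc (suc zero)))) (suc (suc (suc zero))) e = ⊥-elim (adj-≢ (sym G e₃₄) e)
    injective (suc (suc (suc (suc zero)))) (suc (suc (suc (suc zero)))) _ = refl

    realises : ∀ i j → i ≢ j → P5adj i j ⟺ Adj G (vertex i) (vertex j)
    realises zero zero i≢i = ⊥-elim (i≢i refl)
    realises zero (suc zero) _ = present tt e₀₁
    realises zero (suc (suc zero)) _ = absent (λ ()) n₀₂
    realises zero (suc (suc (suc zero))) _ = absent (λ ()) n₀₃
    realises zero (suc (suc (suc (suc zero)))) _ = absent (λ ()) n₀₄
    realises (suc zero) zero _ = present tt (sym G e₀₁)
    realises (suc zero) (suc zero) i≢i = ⊥-elim (i≢i refl)
    realises (suc zero) (suc (suc zero)) _ = present tt e₁₂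
    realises (suc zero) (suc (suc (suc zero))) _ = absent (λ ()) n₁₃
    realises (suc zero) (suc (suc (suc (suc zero)))) _ = absent (λ ()) n₁₄
    realises (suc (suc zero)) zero _ = absent (λ ()) (¬sym n₀₂)
    realises (suc (suc zero)) (suc zero) _ = present tt (sym G e₁₂)
    realises (suc (suc zero)) (suc (suc zero)) i≢i = ⊥-elim (i≢i refl)
    realises (suc (suc zero)) (suc (suc (suc zero))) _ = present tt e₂₃
    realises (suc (suc zero)) (suc (suc (suc (suc zero)))) _ = absent (λ ()) n₂₄
    realises (suc (suc (suc zero))) zero _ = absent (λ ()) (¬sym n₀₃)
    realises (suc (suc (suc zero))) (suc zero) _ = absent (λ ()) (¬sym n₁₃)
    realises (suc (suc (suc zero))) (suc (suc zero)) _ = present tt (sym G e₂₃)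
    realises (suc (suc (suc zero))) (suc (suc (suc zero))) i≢i = ⊥-elim (i≢i refl)
    realises (suc (suc (suc zero))) (suc (suc (suc (suc zero)))) _ = present tt e₃₄
    realises (suc (suc (suc (suc zero)))) zero _ = absent (λ ()) (¬sym n₀₄)
    realises (suc (suc (suc (suc zero)))) (suc zero) _ = absent (λ ()) (¬sym n₁₄)
    realises (suc (suc (suc (suc zero)))) (suc (suc zero)) _ = absent (λ ()) (¬sym n₂₄)
    realises (suc (suc (suc (suc zero)))) (suc (suc (suc zero))) _ = present tt (sym G e₃₄)
    realises (suc (suc (suc (suc zero)))) (suc (suc (suc (suc zero)))) i≢i = ⊥-elim (i≢i refl)

    copy : InducedCopy 5 P5adj G
    copy = vertex , injective , realises

  module InducedKP {x₀ x₁ x₂ x₃ x₄ : V G}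
    (e₀₁ : Adj G x₀ x₁) (e₀₂ : Adj G x₀ x₂) (e₀₃ : Adj G x₀ x₃) (e₀₄ : Adj G x₀ x₄)
    (e₁₂ : Adj G x₁ x₂) (e₁₃ : Adj G x₁ x₃) (e₂₃ : Adj G x₂ x₃)
    (n₁₄ : ¬ Adj G x₁ x₄) (n₂₄ : ¬ Adj G x₂ x₄) (n₃₄ : ¬ Adj G x₃ x₄) where

    vertex : Fin 5 → V G
    vertex = ∀-Fin5 x₀ x₁ x₂ x₃ x₄

    injective : ∀ i j → vertex i ≡ vertex j → i ≡ j
    injective zero zero _ = refl
    injective zero (suc zero) e = ⊥-elim (adj-≢ e₀₁ e)
    injective zero (suc (suc zero)) e = ⊥-elim (adj-≢ e₀₂ e)
    injective zero (suc (suc (suc zero))) e = ⊥-elim (adj-≢ e₀₃ e)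
    injective zero (suc (suc (suc (suc zero)))) e = ⊥-elim (adj-≢ e₀₄ e)
    injective (suc zero) zero e = ⊥-elim (adj-≢ (sym G e₀₁) e)
    injective (suc zero) (suc zero) _ = refl
    injective (suc zero) (suc (suc zero)) e = ⊥-elim (adj-≢ e₁₂ e)
    injective (suc zero) (suc (suc (suc zero))) e = ⊥-elim (adj-≢ e₁₃ e)
    injective (suc zero) (suc (suc (suc (suc zero)))) e = ⊥-elim (separated-≢ (sym G e₁₂) n₂₄ e)
    injective (suc (suc zero)) zero e = ⊥-elim (adj-≢ (sym G e₀₂) e)
    injective (suc (suc zero)) (suc zero) e = ⊥-elim (adj-≢ (sym G e₁₂) e)
    injective (suc (suc zero)) (suc (suc zero)) _ = refl
    injective (suc (suc zero)) (suc (suc (suc zero))) e = ⊥-elim (adj-≢ e₂₃ e)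
    injective (suc (suc zero)) (suc (suc (suc (suc zero)))) e = ⊥-elim (separated-≢ e₁₂ n₁₄ e)
    injective (suc (suc (suc zero))) zero e = ⊥-elim (adj-≢ (sym G e₀₃) e)
    injective (suc (suc (suc zero))) (suc zero) e = ⊥-elim (adj-≢ (sym G e₁₃) e)
    injective (suc (suc (suc zero))) (suc (suc zero)) e = ⊥-elim (adj-≢ (sym G e₂₃) e)
    injective (suc (suc (suc zero))) (suc (suc (suc zero))) _ = refl
    injective (suc (suc (suc zero))) (suc (suc (suc (suc zero)))) e = ⊥-elim (separated-≢ e₁₃ n₁₄ e)
    injective (suc (suc (suc (suc zero)))) zero e = ⊥-elim (adj-≢ (sym G e₀₄) e)
    injective (suc (suc (suc (suc zero)))) (suc zero) e = ⊥-elim (separated-≢ (sym G e₁₂) n₂₄ (≡-sym e))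
    injective (suc (suc (suc (suc zero)))) (suc (suc zero)) e = ⊥-elim (separated-≢ e₁₂ n₁₄ (≡-sym e))
    injective (suc (suc (suc (suc zero)))) (suc (suc (suc zero))) e = ⊥-elim (separated-≢ e₁₃ n₁₄ (≡-sym e))
    injective (suc (suc (suc (suc zero)))) (suc (suc (suc (suc zero)))) _ = refl

    realises : ∀ i j → i ≢ j → KPadj i j ⟺ Adj G (vertex i) (vertex j)
    realises zero zero i≢i = ⊥-elim (i≢i refl)
    realises zero (suc zero) _ = present (tt , tt) e₀₁
    realises zero (suc (suc zero)) _ = present (tt , tt) e₀₂
    realises zero (suc (suc (suc zero))) _ = present (tt , tt) e₀₃
    realises zero (suc (suc (suc (suc zero)))) _ = present tt e₀₄
    realises (suc zero) zero _ = present (tt , tt) (sym G e₀₁)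
    realises (suc zero) (suc zero) i≢i = ⊥-elim (i≢i refl)
    realises (suc zero) (suc (suc zero)) _ = present (tt , tt) e₁₂
    realises (suc zero) (suc (suc (suc zero))) _ = present (tt , tt) e₁₃
    realises (suc zero) (suc (suc (suc (suc zero)))) _ = absent (λ ()) n₁₄
    realises (suc (suc zero)) zero _ = present (tt , tt) (sym G e₀₂)
    realises (suc (suc zero)) (suc zero) _ = present (tt , tt) (sym G e₁₂)
    realises (suc (suc zero)) (suc (suc zero)) i≢i = ⊥-elim (i≢i refl)
    realises (suc (suc zero)) (suc (suc (suc zero))) _ = present (tt , tt) e₂₃
    realises (suc (suc zero)) (suc (suc (suc (suc zero)))) _ = absent (λ ()) n₂₄
    realises (suc (suc (suc zero))) zero _ = present (tt , tt) (sym G e₀₃)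
    realises (suc (suc (suc zero))) (suc zero) _ = present (tt , tt) (sym G e₁₃)
    realises (suc (suc (suc zero))) (suc (suc zero)) _ = present (tt , tt) (sym G e₂₃)
    realises (suc (suc (suc zero))) (suc (suc (suc zero))) i≢i = ⊥-elim (i≢i refl)
    realises (suc (suc (suc zero))) (suc (suc (suc (suc zero)))) _ = absent (λ ()) n₃₄
    realises (suc (suc (suc (suc zero)))) zero _ = present tt (sym G e₀₄)
    realises (suc (suc (suc (suc zero)))) (suc zero) _ = absent (λ ()) (¬sym n₁₄)
    realises (suc (suc (suc (suc zero)))) (suc (suc zero)) _ = absent (λ ()) (¬sym n₂₄)
    realises (suc (suc (suc (suc zero)))) (suc (suc (suc zero))) _ = absent (λ ()) (¬sym n₃₄)
    realises (suc (suc (suc (suc zero)))) (suc (suc (suc (suc zero)))) i≢i = ⊥-elim (i≢i refl)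

    copy : InducedCopy 5 KPadj G
    copy = vertex , injective , realises

  reach-source : ∀ {S : VSet G} {u v} → Reach G S u v → S u
  reach-source (here s) = s
  reach-source (step s _ _) = s

  component-without-edges : ∀ {S T t} → IsComponent G S T → T t →
    (∀ {t'} → T t' → ¬ Adj G t t') → ∀ x → T x → x ≡ t
  component-without-edges {t = t} (_ , _ , connected , _) Tt no-edge x Tx =
    walk (connected t x Tt Tx)
    where
    walk : ∀ {x} → Reach G _ t x → x ≡ t
    walk (here _) = refl
    walk (step _ e r) = ⊥-elim (no-edge (reach-source r) e)

module _ {G : Graph} {c : Fin 5 → V G} where

  N²-far : ∀ {a} → N2 G c a → ∀ j → ¬ Adj G a (c j)
  N²-far (∉C , ∉N , _) j e = ∉N (∉C , j , e)

  N-N²-disjoint : ∀ {x} → NC G c x → ¬ N2 G c x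
  N-N²-disjoint x∈N (_ , ∉N , _) = ∉N x∈N

  complete-to-C : ∀ {u} → N12345 G c u → ∀ j → Adj G u (c j)
  complete-to-C (_ , attached) j = proj₂ (attached j) tt

  -- All that the proof uses about vertices of N32 ∪ N4.
  Straddles : V G → Fin 5 → Set
  Straddles w i = Adj G w (c i) × Adj G w (c (s5 i)) ×
                  Adj G w (c (s5 (s5 (s5 i)))) × ¬ Adj G w (c (s5 (s5 (s5 (s5 i)))))

  straddles : ∀ {w} → N32 G c w ⊎ N4 G c w → ∃[ i ] Straddles w i
  straddles (inj₁ (i , _ , att)) =
    i , proj₂ (att i) (inj₁ refl) , proj₂ (att (s5 i)) (inj₂ (inj₁ refl)) ,
    proj₂ (att _) (inj₂ (inj₂ refl)) , s5⁴∉Pattern32 i ∘ proj₁ (att _)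
  straddles (inj₂ (i , _ , att)) =
    i , proj₂ (att i) (inj₁ refl) , proj₂ (att (s5 i)) (inj₂ (inj₁ refl)) ,
    proj₂ (att _) (inj₂ (inj₂ (inj₂ refl))) , s5⁴∉Pattern4 i ∘ proj₁ (att _)

  module _ (hole : IsHole5 G c) where

    hole-edge : ∀ i → Adj G (c i) (c (s5 i))
    hole-edge i = proj₂ (proj₂ hole i (s5 i)) (inj₁ refl)

    hole-chordless : ∀ i → ¬ Adj G (c i) (c (s5 (s5 i)))
    hole-chordless i =
      [ ≢s5 (s5 i) ∘ ≡-sym , ≢s5³ i ]′ ∘ proj₁ (proj₂ hole i (s5 (s5 i)))

    N²-neighbour-attachment : P5Free G → ∀ {y a} → NC G c y → N2 G c a → Adj G y a →
      N32 G c y ⊎ N4 G c y ⊎ N12345 G c y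
    N²-neighbour-attachment p5-free {y} {a} y∈N a∈N² ya
      with classify-gap-free (λ j → adj? G y (c j)) gap-after gap-before (proj₂ y∈N)
      where
      far = N²-far a∈N²
      gap-after : ∀ j → Adj G y (c j) → ¬ Adj G y (c (s5 j)) → ¬ Adj G y (c (s5 (s5 j))) → ⊥
      gap-after j yj ¬yj₁ ¬yj₂ = p5-free (InducedP5.copy G (sym G ya) yj
        (hole-edge j) (hole-edge (s5 j))
        (far j) (far (s5 j)) (far (s5 (s5 j))) ¬yj₁ ¬yj₂ (hole-chordless j))
      gap-before : ∀ j → Adj G y (c (s5 (s5 j))) → ¬ Adj G y (c (s5 j)) → ¬ Adj G y (c j) → ⊥
      gap-before j yj₂ ¬yj₁ ¬yj = p5-free (InducedP5.copy G (sym G ya) yj₂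
        (sym G (hole-edge (s5 j))) (sym G (hole-edge j))
        (far (s5 (s5 j))) (far (s5 j)) (far j) ¬yj₁ ¬yj (¬sym G (hole-chordless j)))
    ... | inj₁ (i , att) = inj₁ (i , y∈N , att)
    ... | inj₂ (inj₁ (i , att)) = inj₂ (inj₁ (i , y∈N , att))
    ... | inj₂ (inj₂ all) = inj₂ (inj₂ (y∈N , λ j → present (all j) tt))

    -- Otherwise {w, u, c_i, c_{i+1}} is a K4 with t pendant at w.
    shared-N²-neighbour : KPFree G → ∀ {w u t} i → Adj G w u →
      Adj G w (c i) → Adj G w (c (s5 i)) → Adj G u (c i) → Adj G u (c (s5 i)) →
      N2 G c t → Adj G w t → Adj G u t
    shared-N²-neighbour kp-free {u = u} {t} i wu wi wi₁ ui ui₁ t∈N² wt with adj? G u t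
    ... | yes ut = ut
    ... | no ¬ut = ⊥-elim (kp-free (InducedKP.copy G wu wi wi₁ wt ui ui₁ (hole-edge i)
            ¬ut (¬sym G (N²-far t∈N² i)) (¬sym G (N²-far t∈N² (s5 i)))))

    -- Otherwise {c_j, c_{j+1}, y, z} is a K4 with w pendant at c_j.
    sees-complete-edge : KPFree G → ∀ {w y z} j → Adj G w (c j) → ¬ Adj G w (c (s5 j)) →
      Adj G y (c j) → Adj G y (c (s5 j)) → Adj G z (c j) → Adj G z (c (s5 j)) → Adj G y z →
      Adj G w y ⊎ Adj G w z
    sees-complete-edge kp-free {w} {y} {z} j wj ¬wj₁ yj yj₁ zj zj₁ yz
      with adj? G w y | adj? G w z
    ... | yes wy | _ = inj₁ wy
    ... | no _ | yes wz = inj₂ wz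
    ... | no ¬wy | no ¬wz = ⊥-elim (kp-free (InducedKP.copy G (hole-edge j)
            (sym G yj) (sym G zj) (sym G wj) (sym G yj₁) (sym G zj₁) yz
            (¬sym G ¬wj₁) (¬sym G ¬wy) (¬sym G ¬wz)))

    -- Otherwise t' t w c_j v is an induced P5.
    sees-along-N²-edge : P5Free G → ∀ {w v t t'} j → Adj G w (c j) → Adj G (c j) v →
      ¬ Adj G w v → ¬ Adj G v t → ¬ Adj G v t' → N2 G c t → N2 G c t' →
      Adj G w t → Adj G t t' → Adj G w t'
    sees-along-N²-edge p5-free {w} {t' = t'} j wj jv ¬wv ¬vt ¬vt' t∈N² t'∈N² wt tt'
      with adj? G w t'
    ... | yes wt' = wt'
    ... | no ¬wt' = ⊥-elim (p5-free (InducedP5.copy G (sym G tt') (sym G wt) wj jv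
            (¬sym G ¬wt') (N²-far t'∈N² j) (¬sym G ¬vt') (N²-far t∈N² j) (¬sym G ¬vt) ¬wv))

    module _ (p5-free : P5Free G) (kp-free : KPFree G)
             {T : VSet G} (component : IsComponent G (N2 G c) T) where

      private
        in-N² : ∀ {t} → T t → N2 G c t
        in-N² = proj₁ component _

      IsSingleton : V G → Set
      IsSingleton t = ∀ x → (T x → x ≡ t) × (x ≡ t → T x)

      -- An edge t t' of T would make {u, w, t, t'} a K4 with c_{i+4} pendant at u.
      straddler-isolates : ∀ {w u t i} → Straddles w i → N12345 G c u → Adj G w u →
        T t → Adj G w t → IsSingleton t × Adj G t u
      straddler-isolates {w} {u} {t} {i} (wi , wi₁ , wi₃ , ¬wi₄) u∈ wu Tt wt =
        (λ x → component-without-edges G component Tt no-edge x , λ { refl → Tt }) ,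
        sym G (shares Tt wt)
        where
        k₃ = s5 (s5 (s5 i))
        k₄ = s5 k₃
        shares : ∀ {t'} → T t' → Adj G w t' → Adj G u t'
        shares Tt' = shared-N²-neighbour kp-free i wu wi wi₁
          (complete-to-C u∈ i) (complete-to-C u∈ (s5 i)) (in-N² Tt')
        no-edge : ∀ {t'} → T t' → ¬ Adj G t t'
        no-edge {t'} Tt' tt' = kp-free (InducedKP.copy G
            (sym G wu) (shares Tt wt) (shares Tt' wt') (complete-to-C u∈ k₄) wt wt' tt'
            ¬wi₄ (N²-far (in-N² Tt) k₄) (N²-far (in-N² Tt') k₄))
          where
          wt' : Adj G w t'
          wt' = sees-along-N²-edge p5-free k₃ wi₃ (hole-edge k₃) ¬wi₄
            (¬sym G (N²-far (in-N² Tt) k₄)) (¬sym G (N²-far (in-N² Tt') k₄))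
            (in-N² Tt) (in-N² Tt') wt tt'

      singleton-component : (∃[ x ] (Nbd G T x × (N32 G c x ⊎ N4 G c x))) →
        CliqueNumberGE2 G (N12345 G c) → ∃[ t ] (IsSingleton t × ∃[ y ] (N12345 G c y × Adj G t y))
      singleton-component (w , (_ , t , Tt , wt) , w∈) (y , z , y∈ , z∈ , yz) with straddles w∈
      ... | i , shape@(_ , _ , wi₃ , ¬wi₄)
        with sees-complete-edge kp-free (s5 (s5 (s5 i))) wi₃ ¬wi₄
               (complete-to-C y∈ _) (complete-to-C y∈ _)
               (complete-to-C z∈ _) (complete-to-C z∈ _) yz
      ...   | inj₁ wy = let t-only , ty = straddler-isolates shape y∈ wy Tt wt
                        in t , t-only , y , y∈ , ty
      ...   | inj₂ wz = let t-only , tz = straddler-isolates shape z∈ wz Tt wt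
                        in t , t-only , z , z∈ , tz

      triangle-free-component : (∃[ x ] (N32 G c x ⊎ N4 G c x)) →
        ¬ (∃[ x ] (Nbd G T x × (N32 G c x ⊎ N4 G c x))) → K3Free G T
      triangle-free-component (x , x∈) no-attachment (a , b , d , Ta , Tb , Td , ab , bd , ad)
        with straddles x∈ | proj₂ (proj₂ (in-N² Ta))
      ... | i , xi , xi₁ , _ | y , y∈N , ay =
        kp-free (InducedKP.copy G (sym G ay) (sees Tb ab) (sees Td ad) (y-complete zero) ab ad bd
          (N²-far (in-N² Ta) zero) (N²-far (in-N² Tb) zero) (N²-far (in-N² Td) zero))
        where
        x-misses : ∀ {t} → T t → ¬ Adj G x t
        x-misses Tt xt = no-attachment (x , ((λ Tx → N²-far (in-N² Tx) i xi) , _ , Tt , xt) , x∈)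
        y∈N[T] : Nbd G T y
        y∈N[T] = (λ Ty → N-N²-disjoint y∈N (in-N² Ty)) , a , Ta , sym G ay
        y-complete : ∀ j → Adj G y (c j)
        y-complete with N²-neighbour-attachment p5-free y∈N (in-N² Ta) (sym G ay)
        ... | inj₁ y∈N32 = ⊥-elim (no-attachment (y , y∈N[T] , inj₁ y∈N32))
        ... | inj₂ (inj₁ y∈N4) = ⊥-elim (no-attachment (y , y∈N[T] , inj₂ y∈N4))
        ... | inj₂ (inj₂ y∈N12345) = complete-to-C y∈N12345
        ¬yx : ¬ Adj G y x
        ¬yx yx = x-misses Ta (shared-N²-neighbour kp-free i yx
          (y-complete i) (y-complete (s5 i)) xi xi₁ (in-N² Ta) (sym G ay))
        sees : ∀ {t} → T t → Adj G a t → Adj G y t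
        sees Tt at = sees-along-N²-edge p5-free i (y-complete i) (sym G xi) ¬yx
          (x-misses Ta) (x-misses Tt) (in-N² Ta) (in-N² Tt) (sym G ay) at

lemma3p5 : (G : Graph) → Connected G → P5Free G → KPFree G → NoCliqueCutset G →
    (c : Fin 5 → V G) → IsHole5 G c → (T : VSet G) → IsComponent G (N2 G c) T →
    (∃[ x ] (N32 G c x ⊎ N4 G c x)) →
    ((∃[ x ] (Nbd G T x × (N32 G c x ⊎ N4 G c x))) → CliqueNumberGE2 G (N12345 G c) →
    ∃[ t ] ((∀ x → (T x → x ≡ t) × (x ≡ t → T x)) × ∃[ y ] (N12345 G c y × Adj G t y)))
    × ((¬ (∃[ x ] (Nbd G T x × (N32 G c x ⊎ N4 G c x)))) → K3Free G T)
lemma3p5 _ _ p5-free kp-free _ _ hole _ component N32∪N4-nonempty =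
  singleton-component hole p5-free kp-free component ,
  triangle-free-component hole p5-free kp-free component N32∪N4-nonempty
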